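{- Let $M$ be a finite matroid on ground set $E$ with rank function $r$ which is not pseudomodular. Then there exist a flat $B$ of $M$ and a subset $A \subseteq E$ such that $r(A/B) = 1$ and $A \not\blacktriangleleft B$ (i.e. the pseudointersection of $A$ and $B$ does not exist).
   Context: For subsets $A, B \subseteq E$, write $r(A/B) := r(A\cup B) - r(B)$. A flat is a set $F\subseteq E$ with $r(F\cup\{n\})>r(F)$ for all $n\notin F$; $\mathcal{F}$ denotes the set of flats. For $A \subseteq E$ and $B \in \mathcal{F}$, a flat $B_0$ is called the pseudointersection of $A$ and $B$ if for every flat $B_1 \subseteq B$ we have $r(A/B_1) = r(A/B)$ if and only if $B_0 \subseteq B_1$. If the pseudointersection of $A$ and $B$ exists we write $A \blacktriangleleft B$, otherwise $A \not\blacktriangleleft B$. A matroid is pseudomodular if $A \blacktriangleleft B$ for all flats $A, B$. -}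

module Defs where

open import Data.Nat using (ℕ; _≤_; _<_; _+_; _∸_)
open import Data.Fin using (Fin)
open import Data.Fin.Subset using (Subset; _⊆_; _∪_; _∩_; ∣_∣; ⁅_⁆; _∉_)
open import Data.Product using (_×_; Σ; ∃)
open import Relation.Nullary using (¬_)
open import Relation.Binary.PropositionalEquality using (_≡_)
open import Function.Bundles using (_⇔_)

record Matroid (n : ℕ) : Set where
  field
    r          : Subset n → ℕ
    r-bounded  : ∀ X → r X ≤ ∣ X ∣
    r-mono     : ∀ {X Y} → X ⊆ Y → r X ≤ r Y
    r-submod   : ∀ X Y → r (X ∪ Y) + r (X ∩ Y) ≤ r X + r Y

module _ {n : ℕ} (M : Matroid n) where
  open Matroid M

  -- r(A/B) := r(A ∪ B) - r(B)  (well-defined in ℕ by monotonicity)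
  rel : Subset n → Subset n → ℕ
  rel A B = r (A ∪ B) ∸ r B

  IsFlat : Subset n → Set
  IsFlat F = ∀ (e : Fin n) → e ∉ F → r F < r (F ∪ ⁅ e ⁆)

  IsPseudointersection : Subset n → Subset n → Subset n → Set
  IsPseudointersection A B B₀ =
    IsFlat B₀ ×
    (∀ B₁ → IsFlat B₁ → B₁ ⊆ B → ((rel A B₁ ≡ rel A B) ⇔ (B₀ ⊆ B₁)))

  PseudoInt : Subset n → Subset n → Set
  PseudoInt A B = Σ (Subset n) (IsPseudointersection A B)

  IsPseudomodular : Set
  IsPseudomodular = ∀ A B → IsFlat A → IsFlat B → PseudoInt A B

-- If every flat B and set A with r(A/B) = 1 have a pseudointersection, then so do all
-- pairs, by induction on k = r(A/B). For k = 0 the closure of A is the pseudointersection.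
-- Otherwise pick a ∈ A ∖ B; then r(A/B₁) = 1 + r(A/cl(B₁ ∪ a)) for every flat B₁ ∌ a,
-- so by induction A has a pseudointersection Q with cl(B ∪ a), and for flats B₁ ⊆ B the
-- conditions r(A/B₁) = r(A/B), Q ⊆ cl(B₁ ∪ a) and r(Q ∪ a / B₁) = 1 = r(Q ∪ a / B) are
-- all equivalent. Hence the pseudointersection of the rank-one pair (Q ∪ a, B) is that
-- of A and B. Everything is decidable over a finite ground set, so a failing rank-one
-- pair can then be found by search.
module Submission where

open import Defs
open import Data.Nat using (ℕ)
open import Data.Fin.Subset using (Subset)
open import Data.Product using (_×_; Σ)
open import Relation.Nullary using (¬_)
open import Relation.Binary.PropositionalEquality using (_≡_)

open import Data.Bool using (true)
open import Data.Empty using (⊥-elim)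
open import Data.Fin using (Fin)
open import Data.Fin.Properties using (any?; all?)
open import Data.Fin.Subset using (_∈_; _∉_; _⊆_; _⊈_; _∪_; _∩_; ⋃; ⁅_⁆)
open import Data.Fin.Subset.Properties
open import Data.List using (List; map; filter; allFin)
open import Data.List.Membership.Propositional.Properties using (∈-allFin; ∈-filter⁺; ∈-filter⁻)
open import Data.List.Relation.Unary.All as All using (All; []; _∷_)
open import Data.List.Relation.Unary.Any as Any using (Any; here; there)
import Data.List.Relation.Unary.All.Properties as All
import Data.List.Relation.Unary.Any.Properties as Any
open import Data.Nat using (zero; suc; _+_; _≤_; _∸_; _≤?_; _<?_; _≟_)
open import Data.Nat.Properties
open import Data.Product using (_,_; proj₂; ∃)
open import Data.Sum using ([_,_]′; inj₁; inj₂)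
open import Data.Vec using (tabulate)
open import Data.Vec.Properties using ([]=⇒lookup; lookup⇒[]=; lookup∘tabulate)
open import Level using (0ℓ)
open import Function.Bundles using (_⇔_; mk⇔; Equivalence)
open import Function.Construct.Composition using (_⇔-∘_)
open import Function.Construct.Symmetry using (⇔-sym)
open import Function.Related.Propositional using (module EquationalReasoning)
open import Relation.Binary.PropositionalEquality using (refl; sym; trans; cong; cong₂; module ≡-Reasoning)
open import Relation.Nullary using (Dec; yes; no; does; contradiction)
open import Relation.Nullary.Decidable using (decidable-stable; dec-true; map′; ¬?; _×-dec_; _→-dec_)
open import Relation.Unary using (Pred; Decidable)

open Equivalence using (to; from)

private
  variable
    n : ℕ

infix 4 _⇔?_

_⇔?_ : {P Q : Set} → Dec P → Dec Q → Dec (P ⇔ Q)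
P? ⇔? Q? = map′ (λ (f , g) → mk⇔ f g) (λ e → to e , from e) ((P? →-dec Q?) ×-dec (Q? →-dec P?))

≡-cong-⇔ : {A : Set} {x x′ y y′ : A} → x ≡ x′ → y ≡ y′ → (x ≡ y) ⇔ (x′ ≡ y′)
≡-cong-⇔ refl refl = mk⇔ (λ e → e) (λ e → e)

suc-injective-⇔ : {m n : ℕ} → (suc m ≡ suc n) ⇔ (m ≡ n)
suc-injective-⇔ = mk⇔ suc-injective (cong suc)

m∸n≡0⇔m≤n : {m n : ℕ} → (m ∸ n ≡ 0) ⇔ (m ≤ n)
m∸n≡0⇔m≤n = mk⇔ m∸n≡0⇒m≤n m≤n⇒m∸n≡0

allSubset? : {P : Pred (Subset n) 0ℓ} → Decidable P → Dec (∀ X → P X)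
allSubset? P? with anySubset? (λ X → ¬? (P? X))
... | yes (X , ¬PX) = no (λ ∀P → ¬PX (∀P X))
... | no ∄¬P       = yes (λ X → decidable-stable (P? X) (λ ¬PX → ∄¬P (X , ¬PX)))

∃-∈-∉ : {p q : Subset n} → p ⊈ q → ∃ λ x → x ∈ p × x ∉ q
∃-∈-∉ {p = p} {q} p⊈q with any? (λ x → (x ∈? p) ×-dec ¬? (x ∈? q))
... | yes witness = witness
... | no none     = contradiction (λ {x} x∈p → decidable-stable (x ∈? q) (λ x∉q → none (x , x∈p , x∉q))) p⊈q

∪-lub : {p q s : Subset n} → p ⊆ s → q ⊆ s → p ∪ q ⊆ s
∪-lub {p = p} {q} p⊆s q⊆s x∈p∪q = [ p⊆s , q⊆s ]′ (x∈p∪q⁻ p q x∈p∪q)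

∪-mono : {p p′ q q′ : Subset n} → p ⊆ p′ → q ⊆ q′ → p ∪ q ⊆ p′ ∪ q′
∪-mono {q′ = q′} p⊆p′ q⊆q′ = ∪-lub (⊆-trans p⊆p′ (p⊆p∪q q′)) (⊆-trans q⊆q′ (q⊆p∪q _ q′))

x∈p⇒⁅x⁆⊆p : {p : Subset n} {x : Fin n} → x ∈ p → ⁅ x ⁆ ⊆ p
x∈p⇒⁅x⁆⊆p x∈p y∈⁅x⁆ with refl ← x∈⁅y⁆⇒x≡y _ y∈⁅x⁆ = x∈p

x∈⋃⁺ : {x : Fin n} {ps : List (Subset n)} → Any (x ∈_) ps → x ∈ ⋃ ps
x∈⋃⁺ (here x∈p)  = x∈p∪q⁺ (inj₁ x∈p)
x∈⋃⁺ (there x∈ps) = x∈p∪q⁺ (inj₂ (x∈⋃⁺ x∈ps))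

⊆-⋃-⁅⁆ : (p : Subset n) → p ⊆ ⋃ (map ⁅_⁆ (filter (_∈? p) (allFin n)))
⊆-⋃-⁅⁆ p {x} x∈p = x∈⋃⁺ (Any.map⁺ (Any.map (λ { refl → x∈⁅x⁆ x }) (∈-filter⁺ (_∈? p) (∈-allFin x) x∈p)))

comprehension : {P : Pred (Fin n) 0ℓ} → Decidable P → Subset n
comprehension P? = tabulate (λ x → does (P? x))

∈-comprehension-⇔ : {P : Pred (Fin n) 0ℓ} (P? : Decidable P) {x : Fin n} → x ∈ comprehension P? ⇔ P x
∈-comprehension-⇔ P? {x} = mk⇔
  (λ x∈ → does≡true⇒ (P? x) (trans (sym (lookup∘tabulate _ x)) ([]=⇒lookup x∈)))
  (λ Px → lookup⇒[]= x _ (trans (lookup∘tabulate _ x) (dec-true (P? x) Px)))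
  where
  does≡true⇒ : {A : Set} (A? : Dec A) → does A? ≡ true → A
  does≡true⇒ (yes a) _ = a

module MatroidTheory {n : ℕ} (M : Matroid n) where
  open Matroid M

  infix 4 _spans_

  _spans_ : Subset n → Subset n → Set
  Y spans X = r (Y ∪ X) ≤ r Y

  _spans?_ : ∀ Y X → Dec (Y spans X)
  Y spans? X = r (Y ∪ X) ≤? r Y

  ⊆⇒spans : {X Y : Subset n} → X ⊆ Y → Y spans X
  ⊆⇒spans X⊆Y = r-mono (∪-lub ⊆-refl X⊆Y)

  spans-⊆ : {X X′ Y : Subset n} → X′ ⊆ X → Y spans X → Y spans X′
  spans-⊆ X′⊆X Y-spans-X = ≤-trans (r-mono (∪-mono ⊆-refl X′⊆X)) Y-spans-X

  -- Submodularity applied to Z and Y ∪ X, whose intersection contains Y.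
  spans-mono : {X Y Z : Subset n} → Y ⊆ Z → Y spans X → Z spans X
  spans-mono {X} {Y} {Z} Y⊆Z Y-spans-X = +-cancelʳ-≤ (r Y) _ _ (begin
    r (Z ∪ X) + r Y                    ≤⟨ +-mono-≤ (r-mono (∪-mono ⊆-refl (q⊆p∪q Y X)))
                                                   (r-mono (λ y → x∈p∩q⁺ (Y⊆Z y , p⊆p∪q X y))) ⟩
    r (Z ∪ (Y ∪ X)) + r (Z ∩ (Y ∪ X))  ≤⟨ r-submod Z (Y ∪ X) ⟩
    r Z + r (Y ∪ X)                    ≤⟨ +-monoʳ-≤ (r Z) Y-spans-X ⟩
    r Z + r Y                          ∎)
    where
    open ≤-Reasoning

  spans-∪ : {X₁ X₂ Y : Subset n} → Y spans X₁ → Y spans X₂ → Y spans (X₁ ∪ X₂)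
  spans-∪ {X₁} {X₂} {Y} Y-spans-X₁ Y-spans-X₂ = begin
    r (Y ∪ (X₁ ∪ X₂))  ≡⟨ cong r (sym (∪-assoc Y X₁ X₂)) ⟩
    r ((Y ∪ X₁) ∪ X₂)  ≤⟨ spans-mono (p⊆p∪q X₁) Y-spans-X₂ ⟩
    r (Y ∪ X₁)         ≤⟨ Y-spans-X₁ ⟩
    r Y                ∎
    where open ≤-Reasoning

  spans-⋃ : {Xs : List (Subset n)} {Y : Subset n} → All (Y spans_) Xs → Y spans ⋃ Xs
  spans-⋃ []                       = ⊆⇒spans (⊆-min _)
  spans-⋃ (Y-spans-X ∷ Y-spans-Xs) = spans-∪ Y-spans-X (spans-⋃ Y-spans-Xs)

  spans-⁅⁆⇒spans : {X Y : Subset n} → (∀ {x} → x ∈ X → Y spans ⁅ x ⁆) → Y spans X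
  spans-⁅⁆⇒spans {X} Y-spans-⁅x⁆ = spans-⊆ (⊆-⋃-⁅⁆ X)
    (spans-⋃ (All.map⁺ (All.tabulate (λ x∈xs → Y-spans-⁅x⁆ (proj₂ (∈-filter⁻ (_∈? X) {xs = allFin n} x∈xs))))))

  r-∪-⁅⁆ : (X : Subset n) (x : Fin n) → r (X ∪ ⁅ x ⁆) ≤ suc (r X)
  r-∪-⁅⁆ X x = begin
    r (X ∪ ⁅ x ⁆)                    ≤⟨ m≤m+n _ _ ⟩
    r (X ∪ ⁅ x ⁆) + r (X ∩ ⁅ x ⁆)    ≤⟨ r-submod X ⁅ x ⁆ ⟩
    r X + r ⁅ x ⁆                    ≤⟨ +-monoʳ-≤ (r X) (≤-trans (r-bounded ⁅ x ⁆) (≤-reflexive (∣⁅x⁆∣≡1 x))) ⟩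
    r X + 1                          ≡⟨ +-comm (r X) 1 ⟩
    suc (r X)                        ∎
    where open ≤-Reasoning

  cl : Subset n → Subset n
  cl Y = comprehension (λ x → Y spans? ⁅ x ⁆)

  ⊆-cl-⇔ : {X Y : Subset n} → X ⊆ cl Y ⇔ Y spans X
  ⊆-cl-⇔ {X} {Y} = mk⇔
    (λ X⊆clY → spans-⁅⁆⇒spans (λ x∈X → to ∈-cl (X⊆clY x∈X)))
    (λ Y-spans-X {x} x∈X → from ∈-cl (spans-⊆ (x∈p⇒⁅x⁆⊆p x∈X) Y-spans-X))
    where
    ∈-cl : {x : Fin n} → x ∈ cl Y ⇔ Y spans ⁅ x ⁆
    ∈-cl = ∈-comprehension-⇔ (λ x → Y spans? ⁅ x ⁆)

  spans-cl : {Y : Subset n} → Y spans cl Y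
  spans-cl = to ⊆-cl-⇔ ⊆-refl

  ⊆-cl : {Y : Subset n} → Y ⊆ cl Y
  ⊆-cl = from ⊆-cl-⇔ (⊆⇒spans ⊆-refl)

  cl-mono : {Y Z : Subset n} → Y ⊆ Z → cl Y ⊆ cl Z
  cl-mono Y⊆Z = from ⊆-cl-⇔ (spans-mono Y⊆Z spans-cl)

  r-cl : (Y : Subset n) → r (cl Y) ≡ r Y
  r-cl Y = ≤-antisym (≤-trans (r-mono (q⊆p∪q Y (cl Y))) spans-cl) (r-mono ⊆-cl)

  flat-spans-⇔ : {F X : Subset n} → IsFlat M F → F spans X ⇔ X ⊆ F
  flat-spans-⇔ {F} flat = mk⇔ spans⇒⊆ ⊆⇒spans
    where
    spans⇒⊆ : ∀ {X} → F spans X → X ⊆ F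
    spans⇒⊆ F-spans-X {x} x∈X = decidable-stable (x ∈? F)
      (λ x∉F → <⇒≱ (flat x x∉F) (spans-⊆ (x∈p⇒⁅x⁆⊆p x∈X) F-spans-X))

  cl-flat : (Y : Subset n) → IsFlat M (cl Y)
  cl-flat Y x x∉clY = begin-strict
    r (cl Y)          ≡⟨ r-cl Y ⟩
    r Y               <⟨ ≰⇒> (λ Y-spans-x → x∉clY (from ⊆-cl-⇔ Y-spans-x (x∈⁅x⁆ x))) ⟩
    r (Y ∪ ⁅ x ⁆)     ≤⟨ r-mono (∪-mono ⊆-cl ⊆-refl) ⟩
    r (cl Y ∪ ⁅ x ⁆)  ∎
    where open ≤-Reasoning

  cl-⊆-flat-⇔ : {F Y : Subset n} → IsFlat M F → cl Y ⊆ F ⇔ Y ⊆ F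
  cl-⊆-flat-⇔ flat = mk⇔ (⊆-trans ⊆-cl) (λ Y⊆F → to (flat-spans-⇔ flat) (spans-mono Y⊆F spans-cl))

  r-flat-∪-⁅⁆ : {F : Subset n} {x : Fin n} → IsFlat M F → x ∉ F → r (F ∪ ⁅ x ⁆) ≡ suc (r F)
  r-flat-∪-⁅⁆ {F} {x} flat x∉F = ≤-antisym (r-∪-⁅⁆ F x) (flat x x∉F)

  rel≡0-⇔ : {A B : Subset n} → rel M A B ≡ 0 ⇔ B spans A
  rel≡0-⇔ {A} {B} rewrite ∪-comm A B = m∸n≡0⇔m≤n

  rel≡0-flat-⇔ : {A F : Subset n} → IsFlat M F → rel M A F ≡ 0 ⇔ A ⊆ F
  rel≡0-flat-⇔ flat = flat-spans-⇔ flat ⇔-∘ rel≡0-⇔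

  rel-cl-∪-⁅⁆ : {A B : Subset n} {a : Fin n} → a ∈ A → IsFlat M B → a ∉ B →
                rel M A B ≡ suc (rel M A (cl (B ∪ ⁅ a ⁆)))
  rel-cl-∪-⁅⁆ {A} {B} {a} a∈A flat a∉B = begin
    r (A ∪ B) ∸ r B                ≡⟨ +-∸-assoc 1 r-B<r-A∪B ⟩
    suc (r (A ∪ B) ∸ suc (r B))    ≡⟨ cong suc (cong₂ _∸_ (sym r-A∪clY) (sym r-clY)) ⟩
    suc (r (A ∪ cl Y) ∸ r (cl Y))  ∎
    where
    open ≡-Reasoning
    Y = B ∪ ⁅ a ⁆
    Y⊆A∪B : Y ⊆ A ∪ B
    Y⊆A∪B = ∪-lub (q⊆p∪q A B) (⊆-trans (x∈p⇒⁅x⁆⊆p a∈A) (p⊆p∪q B))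
    r-clY : r (cl Y) ≡ suc (r B)
    r-clY = trans (r-cl Y) (r-flat-∪-⁅⁆ flat a∉B)
    r-B<r-A∪B : suc (r B) ≤ r (A ∪ B)
    r-B<r-A∪B = ≤-trans (≤-reflexive (sym (r-flat-∪-⁅⁆ flat a∉B))) (r-mono Y⊆A∪B)
    r-A∪clY : r (A ∪ cl Y) ≡ r (A ∪ B)
    r-A∪clY = ≤-antisym
      (≤-trans (r-mono (∪-mono (p⊆p∪q B) ⊆-refl)) (spans-mono Y⊆A∪B spans-cl))
      (r-mono (∪-mono ⊆-refl (⊆-trans (p⊆p∪q ⁅ a ⁆) ⊆-cl)))

  rel-∪-⁅⁆≡1-⇔ : {B Q : Subset n} {a : Fin n} → IsFlat M B → a ∉ B →
                 rel M (Q ∪ ⁅ a ⁆) B ≡ 1 ⇔ Q ⊆ cl (B ∪ ⁅ a ⁆)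
  rel-∪-⁅⁆≡1-⇔ {B} {Q} {a} flat a∉B = begin
    (rel M (Q ∪ ⁅ a ⁆) B ≡ 1)            ∼⟨ ≡-cong-⇔ (rel-cl-∪-⁅⁆ a∈Q∪a flat a∉B) refl ⟩
    (suc (rel M (Q ∪ ⁅ a ⁆) (cl Y)) ≡ 1)  ∼⟨ suc-injective-⇔ ⟩
    (rel M (Q ∪ ⁅ a ⁆) (cl Y) ≡ 0)        ∼⟨ rel≡0-flat-⇔ (cl-flat Y) ⟩
    Q ∪ ⁅ a ⁆ ⊆ cl Y                      ∼⟨ ∪-⁅a⁆-⊆-⇔ ⟩
    Q ⊆ cl Y                              ∎
    where
    open EquationalReasoning
    Y = B ∪ ⁅ a ⁆
    a∈Q∪a : a ∈ Q ∪ ⁅ a ⁆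
    a∈Q∪a = q⊆p∪q Q ⁅ a ⁆ (x∈⁅x⁆ a)
    ∪-⁅a⁆-⊆-⇔ : Q ∪ ⁅ a ⁆ ⊆ cl Y ⇔ Q ⊆ cl Y
    ∪-⁅a⁆-⊆-⇔ = mk⇔ (⊆-trans (p⊆p∪q ⁅ a ⁆)) (λ Q⊆ → ∪-lub Q⊆ (⊆-trans (q⊆p∪q B ⁅ a ⁆) ⊆-cl))

  cl-isPseudointersection : {A B : Subset n} → rel M A B ≡ 0 → IsPseudointersection M A B (cl A)
  cl-isPseudointersection rel≡0 = cl-flat _ , λ B₁ flat₁ _ →
    ⇔-sym (cl-⊆-flat-⇔ flat₁) ⇔-∘ (rel≡0-flat-⇔ flat₁ ⇔-∘ ≡-cong-⇔ refl rel≡0)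

  pseudointersection-⊆ : {A B Q : Subset n} → IsFlat M B → IsPseudointersection M A B Q → Q ⊆ B
  pseudointersection-⊆ {B = B} flat (_ , Q-pi) = to (Q-pi B flat ⊆-refl) refl

  pseudointersection-step : {A B Q P : Subset n} {a : Fin n} → a ∈ A → IsFlat M B → a ∉ B →
    IsPseudointersection M A (cl (B ∪ ⁅ a ⁆)) Q → IsPseudointersection M (Q ∪ ⁅ a ⁆) B P →
    IsPseudointersection M A B P
  pseudointersection-step {A} {B} {Q} {P} {a} a∈A flat a∉B Q-is@(_ , Q-pi) (P-flat , P-pi) =
    P-flat , λ B₁ flat₁ B₁⊆B → let a∉B₁ = λ a∈B₁ → a∉B (B₁⊆B a∈B₁) in begin
      (rel M A B₁ ≡ rel M A B)
        ∼⟨ ≡-cong-⇔ (rel-cl-∪-⁅⁆ a∈A flat₁ a∉B₁) (rel-cl-∪-⁅⁆ a∈A flat a∉B) ⟩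
      (suc (rel M A (cl (B₁ ∪ ⁅ a ⁆))) ≡ suc (rel M A (cl (B ∪ ⁅ a ⁆))))
        ∼⟨ suc-injective-⇔ ⟩
      (rel M A (cl (B₁ ∪ ⁅ a ⁆)) ≡ rel M A (cl (B ∪ ⁅ a ⁆)))
        ∼⟨ Q-pi _ (cl-flat _) (cl-mono (∪-mono B₁⊆B ⊆-refl)) ⟩
      Q ⊆ cl (B₁ ∪ ⁅ a ⁆)
        ∼⟨ ⇔-sym (rel-∪-⁅⁆≡1-⇔ flat₁ a∉B₁) ⟩
      (rel M (Q ∪ ⁅ a ⁆) B₁ ≡ 1)
        ∼⟨ ≡-cong-⇔ refl (sym rel-Q∪a≡1) ⟩
      (rel M (Q ∪ ⁅ a ⁆) B₁ ≡ rel M (Q ∪ ⁅ a ⁆) B)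
        ∼⟨ P-pi B₁ flat₁ B₁⊆B ⟩
      P ⊆ B₁ ∎
    where
    open EquationalReasoning
    rel-Q∪a≡1 : rel M (Q ∪ ⁅ a ⁆) B ≡ 1
    rel-Q∪a≡1 = from (rel-∪-⁅⁆≡1-⇔ flat a∉B) (pseudointersection-⊆ (cl-flat _) Q-is)

  module _ (rank-one : ∀ {A B} → IsFlat M B → rel M A B ≡ 1 → PseudoInt M A B) where

    pseudoint-of-rel≡ : ∀ k {A B} → IsFlat M B → rel M A B ≡ k → PseudoInt M A B
    pseudoint-of-rel≡ zero    _ rel≡0 = cl _ , cl-isPseudointersection rel≡0
    pseudoint-of-rel≡ (suc k) flat rel≡1+k
      with a , a∈A , a∉B ← ∃-∈-∉ (λ A⊆B → 0≢1+n (trans (sym (from rel≡0-⇔ (⊆⇒spans A⊆B))) rel≡1+k))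
      with Q , Q-is ← pseudoint-of-rel≡ k (cl-flat _)
                        (suc-injective (trans (sym (rel-cl-∪-⁅⁆ a∈A flat a∉B)) rel≡1+k))
      with P , P-is ← rank-one flat
                        (from (rel-∪-⁅⁆≡1-⇔ flat a∉B) (pseudointersection-⊆ (cl-flat _) Q-is))
      = P , pseudointersection-step a∈A flat a∉B Q-is P-is

    pseudomodular-of-rank-one : IsPseudomodular M
    pseudomodular-of-rank-one _ _ _ flat = pseudoint-of-rel≡ _ flat refl

  IsFlat? : ∀ F → Dec (IsFlat M F)
  IsFlat? F = all? (λ x → ¬? (x ∈? F) →-dec (r F <? r (F ∪ ⁅ x ⁆)))

  PseudoInt? : ∀ A B → Dec (PseudoInt M A B)
  PseudoInt? A B = anySubset? λ B₀ → IsFlat? B₀ ×-dec allSubset? λ B₁ →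
    IsFlat? B₁ →-dec (B₁ ⊆? B →-dec ((rel M A B₁ ≟ rel M A B) ⇔? (B₀ ⊆? B₁)))

open MatroidTheory

lemma1 : ∀ {n : ℕ} (M : Matroid n) → ¬ IsPseudomodular M →
    Σ (Subset n) λ B → Σ (Subset n) λ A →
    IsFlat M B × rel M A B ≡ 1 × ¬ PseudoInt M A B
lemma1 M ¬pm with anySubset? (λ B → anySubset? λ A →
                    IsFlat? M B ×-dec rel M A B ≟ 1 ×-dec ¬? (PseudoInt? M A B))
... | yes counterexample = counterexample
... | no none = ⊥-elim (¬pm (pseudomodular-of-rank-one M λ {A} {B} flat rel≡1 →
                  decidable-stable (PseudoInt? M A B) (λ ¬pi → none (B , A , flat , rel≡1 , ¬pi))))
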